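{- Let $d>3$ be an integer. Then $d$ is HS-prime partitionable if and only if $d$ is TE-prime partitionable (both notions as defined in the context below).
   Context: An integer $n$ is called HS-prime partitionable if there is a partition $\{\mathbb{P}_1,\mathbb{P}_2\}$ of the set of all primes less than $n$ into two nonempty disjoint sets such that for all positive integers $n_1,n_2$ with $n_1+n_2=n$ there is some pair $(p_1,p_2)\in\mathbb{P}_1\times\mathbb{P}_2$ with $\gcd(n_1,p_1)>1$ or $\gcd(n_2,p_2)>1$. An integer $d$ is called TE-prime partitionable if there exist positive integers $n_1,n_2$ with $d=\gcd(n_1,n_2)$ such that for every pair of positive integers $d_1,d_2$ with $d_1+d_2=d$, either $\gcd(n_1,d_1)\neq 1$ or $\gcd(n_2,d_2)\neq 1$. -}

module Defs where

open import Data.Nat using (ℕ; _+_; _<_; _>_)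
open import Data.Nat.GCD using (gcd)
open import Data.Nat.Primality using (Prime)
open import Data.Bool using (Bool; true; false)
open import Data.Product using (∃-syntax; _×_)
open import Data.Sum using (_⊎_)
open import Relation.Binary.PropositionalEquality using (_≡_; _≢_)

-- A partition {P₁, P₂} of the set of primes < n is encoded by a colouring
-- c : ℕ → Bool : P₁ = primes p < n with c p ≡ true,
--                P₂ = primes p < n with c p ≡ false.
-- (Disjointness and covering are automatic; every partition arises this way.)
InP₁ : ℕ → (ℕ → Bool) → ℕ → Set
InP₁ n c p = Prime p × p < n × c p ≡ true

InP₂ : ℕ → (ℕ → Bool) → ℕ → Set
InP₂ n c p = Prime p × p < n × c p ≡ false

HS-prime-partitionable : ℕ → Set
HS-prime-partitionable n =
  ∃[ c ] ( (∃[ p ] InP₁ n c p)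
         × (∃[ p ] InP₂ n c p)
         × (∀ n₁ n₂ → n₁ > 0 → n₂ > 0 → n₁ + n₂ ≡ n →
              ∃[ p₁ ] ∃[ p₂ ] (InP₁ n c p₁ × InP₂ n c p₂ ×
                (gcd n₁ p₁ > 1 ⊎ gcd n₂ p₂ > 1))))

TE-prime-partitionable : ℕ → Set
TE-prime-partitionable d =
  ∃[ n₁ ] ∃[ n₂ ] (n₁ > 0 × n₂ > 0 × d ≡ gcd n₁ n₂ ×
    (∀ d₁ d₂ → d₁ > 0 → d₂ > 0 → d₁ + d₂ ≡ d →
       gcd n₁ d₁ ≢ 1 ⊎ gcd n₂ d₂ ≢ 1))

module Submission where

-- Both notions are reformulated through prime divisors and converted into
-- each other directly; the argument works for every d ≥ 2 (the hypothesis
-- d > 3 of the theorem is only used in this weaker form).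
--
-- HS ⇒ TE.  Given a colouring c of the primes below d, let A (resp. B) be the
-- product of the primes below d of colour true (resp. false), and take
-- n₁ = d·A, n₂ = d·B.  A and B have no common prime factor, so
-- gcd n₁ n₂ = d·gcd A B = d.  For a split d₁ + d₂ = d the HS property gives
-- p₁ of colour true with p₁ ∣ d₁ (then p₁ ∣ gcd n₁ d₁) or p₂ of colour false
-- with p₂ ∣ d₂ (then p₂ ∣ gcd n₂ d₂).
--
-- TE ⇒ HS.  Given n₁, n₂ with gcd n₁ n₂ = d, put a prime in P₂ iff it divides
-- n₂.  A prime dividing n₁ and a summand a of a split a + b = d either lies in
-- P₁, or also divides n₂, hence d, hence b.  The splits (d-1, 1) and (1, d-1)
-- provide a prime q ∈ P₁ and a prime r ∈ P₂, which pair up with the prime that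
-- the TE property yields for an arbitrary split.

open import Defs
open import Data.Nat
  using (ℕ; zero; suc; _+_; _*_; _<_; _>_; z<s; s≤s; _≟_; ≢-nonZero; >-nonZero; >-nonZero⁻¹; nonTrivial⇒n>1)
open import Data.Nat.Properties
  using (<-irrefl; n>0⇒n≢0; ≤-<-trans; m<m+n; m<1+n⇒m<n∨m≡n; +-comm; *-identityʳ)
open import Data.Nat.Divisibility
  using (_∣_; _∣?_; ∣-refl; ∣-trans; ∣-antisym; ∣1⇒≡1; ∣⇒≤;
         ∣m+n∣m⇒∣n; m∣m*n; ∣m⇒∣m*n; ∣n⇒∣m*n)
open import Data.Nat.GCD using (gcd; gcd[m,n]∣m; gcd[m,n]∣n; gcd[m,n]≢0; gcd-greatest; gcd-zeroʳ; c*gcd[m,n]≡gcd[cm,cn])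
open import Data.Nat.Primality using (Prime; prime?; ¬prime[1]; euclidsLemma; prime⇒irreducible; prime⇒nonZero; prime⇒nonTrivial)
open import Data.Nat.Primality.Factorisation using (factorise)
open import Data.List using ([]; _∷_)
open import Data.Nat.ListAction using (product)
open import Data.List.Relation.Unary.All using (_∷_)
open import Data.Bool using (Bool; true; false; not)
open import Data.Bool.Properties using () renaming (_≟_ to _≟ᵇ_)
open import Data.Product using (∃-syntax; _×_; _,_)
open import Data.Sum using (_⊎_; inj₁; inj₂)
open import Data.Empty using (⊥; ⊥-elim)
open import Function.Bundles using (_⇔_; mk⇔)
open import Relation.Nullary using (¬_; yes; no; does)
open import Relation.Nullary.Decidable using (_×-dec_)
open import Level using (0ℓ)
open import Relation.Unary using (Pred; Decidable)
open import Relation.Binary.PropositionalEquality using (_≡_; _≢_; refl; sym; trans; cong; subst)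
open Relation.Binary.PropositionalEquality.≡-Reasoning

prime∤1 : ∀ {p} → Prime p → ¬ p ∣ 1
prime∤1 pp p∣1 = ¬prime[1] (subst Prime (∣1⇒≡1 p∣1) pp)

prime∣prime⇒≡ : ∀ {p q} → Prime p → Prime q → q ∣ p → q ≡ p
prime∣prime⇒≡ pp qp q∣p with prime⇒irreducible pp q∣p
... | inj₁ q≡1 = ⊥-elim (¬prime[1] (subst Prime q≡1 qp))
... | inj₂ q≡p = q≡p

prime-divisor : ∀ {n} → n ≢ 0 → n ≢ 1 → ∃[ p ] (Prime p × p ∣ n)
prime-divisor {n} n≢0 n≢1 with factorise n {{≢-nonZero n≢0}}
... | record { factors = [] ; isFactorisation = n≡1 } = ⊥-elim (n≢1 n≡1)
... | record { factors = p ∷ ps ; isFactorisation = n≡p*ps ; factorsPrime = pp ∷ _ } =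
  p , pp , subst (p ∣_) (sym n≡p*ps) (m∣m*n (product ps))

common-prime-divisor : ∀ m n → n > 0 → gcd m n ≢ 1 → ∃[ p ] (Prime p × p ∣ m × p ∣ n)
common-prime-divisor m n n>0 gcd≢1
  with prime-divisor (gcd[m,n]≢0 m n (inj₂ (n>0⇒n≢0 n>0))) gcd≢1
... | p , pp , p∣gcd = p , pp , ∣-trans p∣gcd (gcd[m,n]∣m m n) , ∣-trans p∣gcd (gcd[m,n]∣n m n)

no-common-prime⇒gcd≡1 : ∀ {m n} → n > 0 → (∀ {p} → Prime p → p ∣ m → p ∣ n → ⊥) → gcd m n ≡ 1
no-common-prime⇒gcd≡1 {m} {n} n>0 no-common with gcd m n ≟ 1
... | yes gcd≡1 = gcd≡1
... | no gcd≢1 with common-prime-divisor m n n>0 gcd≢1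
...   | p , pp , p∣m , p∣n = ⊥-elim (no-common pp p∣m p∣n)

common-prime⇒gcd≢1 : ∀ {p m n} → Prime p → p ∣ m → p ∣ n → gcd m n ≢ 1
common-prime⇒gcd≢1 pp p∣m p∣n gcd≡1 = prime∤1 pp (subst (_ ∣_) gcd≡1 (gcd-greatest p∣m p∣n))

gcd>1⇒prime∣ : ∀ {m p} → Prime p → gcd m p > 1 → p ∣ m
gcd>1⇒prime∣ {m} {p} pp gcd>1 with prime⇒irreducible pp (gcd[m,n]∣n m p)
... | inj₁ gcd≡1 = ⊥-elim (<-irrefl (sym gcd≡1) gcd>1)
... | inj₂ gcd≡p = subst (_∣ m) gcd≡p (gcd[m,n]∣m m p)

prime∣⇒gcd>1 : ∀ {m p} → Prime p → p ∣ m → gcd m p > 1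
prime∣⇒gcd>1 {m} {p} pp p∣m =
  subst (_> 1) (∣-antisym (gcd-greatest p∣m ∣-refl) (gcd[m,n]∣n m p)) (nonTrivial⇒n>1 p {{prime⇒nonTrivial pp}})

∣left-summand⇒< : ∀ {p a b d} → a > 0 → b > 0 → a + b ≡ d → p ∣ a → p < d
∣left-summand⇒< {a = a} a>0 b>0 a+b≡d p∣a =
  ≤-<-trans (∣⇒≤ {{>-nonZero a>0}} p∣a) (subst (a <_) a+b≡d (m<m+n a b>0))

∣right-summand⇒< : ∀ {p a b d} → a > 0 → b > 0 → a + b ≡ d → p ∣ b → p < d
∣right-summand⇒< {a = a} {b} a>0 b>0 a+b≡d = ∣left-summand⇒< b>0 a>0 (trans (+-comm b a) a+b≡d)

*-pos : ∀ {m n} → m > 0 → n > 0 → m * n > 0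
*-pos {suc m} {suc n} _ _ = z<s

module ProductBelow {P : Pred ℕ 0ℓ} (P? : Decidable P) where

  factorIf : ℕ → ℕ
  factorIf k with P? k
  ... | yes _ = k
  ... | no _ = 1

  productBelow : ℕ → ℕ
  productBelow zero = 1
  productBelow (suc n) = factorIf n * productBelow n

  productBelow>0 : (∀ {k} → P k → k > 0) → ∀ n → productBelow n > 0
  productBelow>0 P⇒>0 zero = z<s
  productBelow>0 P⇒>0 (suc n) = *-pos factor>0 (productBelow>0 P⇒>0 n)
    where
    factor>0 : factorIf n > 0
    factor>0 with P? n
    ... | yes Pn = P⇒>0 Pn
    ... | no _ = z<s

  ∣productBelow : ∀ {k n} → P k → k < n → k ∣ productBelow n
  ∣productBelow {k} {suc n} Pk k<1+n with m<1+n⇒m<n∨m≡n k<1+n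
  ... | inj₁ k<n = ∣n⇒∣m*n (factorIf n) (∣productBelow Pk k<n)
  ... | inj₂ refl = ∣m⇒∣m*n (productBelow k) k∣factor
    where
    k∣factor : k ∣ factorIf k
    k∣factor with P? k
    ... | yes _ = ∣-refl
    ... | no ¬Pk = ⊥-elim (¬Pk Pk)

  prime∣productBelow : ∀ {q} n → Prime q → q ∣ productBelow n → ∃[ k ] (P k × q ∣ k)
  prime∣productBelow zero qp q∣1 = ⊥-elim (prime∤1 qp q∣1)
  prime∣productBelow (suc n) qp q∣prod with euclidsLemma (factorIf n) (productBelow n) qp q∣prod
  ... | inj₂ q∣rest = prime∣productBelow n qp q∣rest
  ... | inj₁ q∣factor with P? n
  ...   | yes Pn = n , Pn , q∣factor
  ...   | no _ = ⊥-elim (prime∤1 qp q∣factor)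

open ProductBelow using (productBelow; productBelow>0; ∣productBelow; prime∣productBelow)

HasColour : (ℕ → Bool) → Bool → Pred ℕ 0ℓ
HasColour c b k = Prime k × c k ≡ b

hasColour? : ∀ c b → Decidable (HasColour c b)
hasColour? c b k = prime? k ×-dec (c k ≟ᵇ b)

colourProduct : (ℕ → Bool) → Bool → ℕ → ℕ
colourProduct c b = productBelow (hasColour? c b)

prime∣colourProduct⇒colour : ∀ c b n {q} → Prime q → q ∣ colourProduct c b n → c q ≡ b
prime∣colourProduct⇒colour c b n qp q∣prod with prime∣productBelow (hasColour? c b) n qp q∣prod
... | k , (kp , ck≡b) , q∣k = subst (λ x → c x ≡ b) (sym (prime∣prime⇒≡ kp qp q∣k)) ck≡b

colourProduct>0 : ∀ c b n → colourProduct c b n > 0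
colourProduct>0 c b = productBelow>0 (hasColour? c b) λ {k} (kp , _) → >-nonZero⁻¹ k {{prime⇒nonZero kp}}

colourProducts-coprime : ∀ c n → gcd (colourProduct c true n) (colourProduct c false n) ≡ 1
colourProducts-coprime c n = no-common-prime⇒gcd≡1 (colourProduct>0 c false n) λ qp q∣A q∣B →
  true≢false (trans (sym (prime∣colourProduct⇒colour c true n qp q∣A))
                    (prime∣colourProduct⇒colour c false n qp q∣B))
  where
  true≢false : true ≢ false
  true≢false ()

gcd-scaled-coprime : ∀ d {a b} → gcd a b ≡ 1 → gcd (d * a) (d * b) ≡ d
gcd-scaled-coprime d {a} {b} gcd≡1 = begin
  gcd (d * a) (d * b) ≡⟨ sym (c*gcd[m,n]≡gcd[cm,cn] d a b) ⟩
  d * gcd a b         ≡⟨ cong (d *_) gcd≡1 ⟩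
  d * 1               ≡⟨ *-identityʳ d ⟩
  d                   ∎

hs⇒te : ∀ d → d > 0 → HS-prime-partitionable d → TE-prime-partitionable d
hs⇒te d d>0 (c , _ , _ , hs-split) =
  d * A , d * B , *-pos d>0 (colourProduct>0 c true d) , *-pos d>0 (colourProduct>0 c false d) ,
  sym (gcd-scaled-coprime d (colourProducts-coprime c d)) , te-split
  where
  A B : ℕ
  A = colourProduct c true d
  B = colourProduct c false d

  ∣scaled : ∀ b {p} → Prime p → p < d → c p ≡ b → p ∣ d * colourProduct c b d
  ∣scaled b pp p<d cp≡b = ∣n⇒∣m*n d (∣productBelow (hasColour? c b) (pp , cp≡b) p<d)

  te-split : ∀ d₁ d₂ → d₁ > 0 → d₂ > 0 → d₁ + d₂ ≡ d → gcd (d * A) d₁ ≢ 1 ⊎ gcd (d * B) d₂ ≢ 1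
  te-split d₁ d₂ d₁>0 d₂>0 sum with hs-split d₁ d₂ d₁>0 d₂>0 sum
  ... | p₁ , _ , (p₁-prime , p₁<d , cp₁) , _ , inj₁ gcd>1 =
    inj₁ (common-prime⇒gcd≢1 p₁-prime (∣scaled true p₁-prime p₁<d cp₁) (gcd>1⇒prime∣ p₁-prime gcd>1))
  ... | _ , p₂ , _ , (p₂-prime , p₂<d , cp₂) , inj₂ gcd>1 =
    inj₂ (common-prime⇒gcd≢1 p₂-prime (∣scaled false p₂-prime p₂<d cp₂) (gcd>1⇒prime∣ p₂-prime gcd>1))

colourByDivisibility : ℕ → ℕ → Bool
colourByDivisibility n p = not (does (p ∣? n))

∣⇒inP₂ : ∀ {n d p} → Prime p → p ∣ n → p < d → InP₂ d (colourByDivisibility n) p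
∣⇒inP₂ {n} {p = p} pp p∣n p<d = pp , p<d , colour-false
  where
  colour-false : colourByDivisibility n p ≡ false
  colour-false with p ∣? n
  ... | yes _ = refl
  ... | no p∤n = ⊥-elim (p∤n p∣n)

∤⇒inP₁ : ∀ {n d p} → Prime p → ¬ p ∣ n → p < d → InP₁ d (colourByDivisibility n) p
∤⇒inP₁ {n} {p = p} pp p∤n p<d = pp , p<d , colour-true
  where
  colour-true : colourByDivisibility n p ≡ true
  colour-true with p ∣? n
  ... | yes p∣n = ⊥-elim (p∤n p∣n)
  ... | no _ = refl

te⇒hs : ∀ k → k > 0 → TE-prime-partitionable (suc k) → HS-prime-partitionable (suc k)
te⇒hs k k>0 (n₁ , n₂ , _ , _ , d≡gcd , te-split) = c , P₁-inhabited , P₂-inhabited , hs-split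
  where
  d : ℕ
  d = suc k

  c : ℕ → Bool
  c = colourByDivisibility n₂

  shared-prime∣other : ∀ {p a b} → a + b ≡ d → p ∣ n₁ → p ∣ n₂ → p ∣ a → p ∣ b
  shared-prime∣other sum p∣n₁ p∣n₂ p∣a =
    ∣m+n∣m⇒∣n (subst (_ ∣_) (trans (sym d≡gcd) (sym sum)) (gcd-greatest p∣n₁ p∣n₂)) p∣a

  -- The split (k, 1) yields a prime q ∣ gcd n₁ k; it does not divide n₂,
  -- since it would then divide 1.
  P₁-inhabited : ∃[ q ] InP₁ d c q
  P₁-inhabited with te-split k 1 k>0 z<s (+-comm k 1)
  ... | inj₂ gcd≢1 = ⊥-elim (gcd≢1 (gcd-zeroʳ n₂))
  ... | inj₁ gcd≢1 with common-prime-divisor n₁ k k>0 gcd≢1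
  ...   | q , qp , q∣n₁ , q∣k =
    q , ∤⇒inP₁ qp (λ q∣n₂ → prime∤1 qp (shared-prime∣other (+-comm k 1) q∣n₁ q∣n₂ q∣k))
                  (∣left-summand⇒< k>0 z<s (+-comm k 1) q∣k)

  P₂-inhabited : ∃[ r ] InP₂ d c r
  P₂-inhabited with te-split 1 k z<s k>0 refl
  ... | inj₁ gcd≢1 = ⊥-elim (gcd≢1 (gcd-zeroʳ n₁))
  ... | inj₂ gcd≢1 with common-prime-divisor n₂ k k>0 gcd≢1
  ...   | r , rp , r∣n₂ , r∣k = r , ∣⇒inP₂ rp r∣n₂ (∣right-summand⇒< z<s k>0 refl r∣k)

  Witness : ℕ → ℕ → Set
  Witness a b = ∃[ p₁ ] ∃[ p₂ ] (InP₁ d c p₁ × InP₂ d c p₂ × (gcd a p₁ > 1 ⊎ gcd b p₂ > 1))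

  witness-in-P₂ : ∀ {a b p} → a > 0 → b > 0 → a + b ≡ d → Prime p → p ∣ n₂ → p ∣ b → Witness a b
  witness-in-P₂ {p = p} a>0 b>0 sum pp p∣n₂ p∣b with P₁-inhabited
  ... | q , q∈P₁ = q , p , q∈P₁ , ∣⇒inP₂ pp p∣n₂ (∣right-summand⇒< a>0 b>0 sum p∣b) , inj₂ (prime∣⇒gcd>1 pp p∣b)

  -- A prime of gcd n₂ b lies in P₂; a prime of gcd n₁ a lies in P₁ unless it
  -- divides n₂, in which case it also divides b.
  hs-split : ∀ a b → a > 0 → b > 0 → a + b ≡ d → Witness a b
  hs-split a b a>0 b>0 sum with te-split a b a>0 b>0 sum
  ... | inj₂ gcd≢1 with common-prime-divisor n₂ b b>0 gcd≢1
  ...   | p , pp , p∣n₂ , p∣b = witness-in-P₂ a>0 b>0 sum pp p∣n₂ p∣b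
  hs-split a b a>0 b>0 sum | inj₁ gcd≢1 with common-prime-divisor n₁ a a>0 gcd≢1
  ...   | p , pp , p∣n₁ , p∣a with p ∣? n₂
  ...     | yes p∣n₂ = witness-in-P₂ a>0 b>0 sum pp p∣n₂ (shared-prime∣other sum p∣n₁ p∣n₂ p∣a)
  ...     | no p∤n₂ with P₂-inhabited
  ...       | r , r∈P₂ =
    p , r , ∤⇒inP₁ pp p∤n₂ (∣left-summand⇒< a>0 b>0 sum p∣a) , r∈P₂ , inj₁ (prime∣⇒gcd>1 pp p∣a)

theorem1 : (d : ℕ) → d > 3 → HS-prime-partitionable d ⇔ TE-prime-partitionable d
theorem1 1 (s≤s ())
theorem1 (suc (suc k)) _ = mk⇔ (hs⇒te (suc (suc k)) z<s) (te⇒hs (suc k) z<s)
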